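{- Let $P$ be a set of $n\geq 5$ points in general position in the plane, let $\mathcal{S}\subseteq\mathcal{P}$ and $s:=|\mathcal{S}|$, and let $\mathcal{P}':=\mathcal{P}\setminus\mathcal{S}$. Suppose that each pair of distinct segments $a,b\in\mathcal{P}'$ satisfies exactly one of the following conditions: (1) $d_{D(P)}(a,b)=1$ (equivalently $a\cap b=\emptyset$); (2) $d_{D(P)}(a,b)=2$ and there is $f_1\in\mathcal{S}$ with $(a\cup b)\cap f_1=\emptyset$; (3) $d_{D(P)}(a,b)=3$ and there are $f_1,f_2\in\mathcal{S}$ with $a\cap f_1=\emptyset$, $f_1\cap f_2=\emptyset$ and $f_2\cap b=\emptyset$; (4) $d_{D(P)}(a,b)=4$, $n=5$, and there are $f_1,f_2,f_3\in\mathcal{S}$ with $a\cap f_1=\emptyset=f_3\cap b$, $a\cap h\neq\emptyset$ for $h\in\{f_2,f_3\}$, $b\cap h\neq\emptyset$ for $h\in\{f_1,f_2\}$, $f_i\cap f_{i+1}=\emptyset$ for $i\in\{1,2\}$, and $f_1\cap f_3\neq\emptyset$. Then $\mu(D(P))\geq\binom{n}{2}-s$.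
   Context: A set of points in the plane is in general position if no three are collinear. For distinct $x,y\in P$, $xy$ is the closed segment with endpoints $x,y$; $\mathcal{P}$ is the set of all $\binom n2$ such segments. $D(P)$ is the graph with vertex set $\mathcal{P}$, two segments adjacent iff disjoint; $d_{D(P)}$ denotes graph distance in $D(P)$. For a graph $G$ and $U\subseteq V(G)$, two distinct vertices $x,y\in U$ are $U$-mutually visible if $G$ contains a shortest $x$-$y$ path none of whose internal vertices lies in $U$; $U$ is a mutual-visibility set if every two distinct vertices of $U$ are $U$-mutually visible; $\mu(G)$ is the largest size of a mutual-visibility set of $G$. -}

module Defs where

open import Level using (0ℓ) renaming (suc to lsuc)
open import Algebra.Bundles using (CommutativeRing)
open import Relation.Binary.Core using (Rel)
open import Relation.Binary.Structures using (IsTotalOrder)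
open import Relation.Nullary using (¬_)
open import Relation.Binary.PropositionalEquality using (_≡_)
open import Data.Product using (Σ; ∃; _×_; _,_)
open import Data.Sum using (_⊎_)
open import Data.Bool using (Bool; true; false)
open import Data.Nat as ℕ using (ℕ)
open import Data.Fin as Fin using (Fin)
open import Data.List using (List; []; _∷_; length; filter; concatMap; allFin)
open import Relation.Nullary.Decidable using (Dec; yes; no)
open import Data.Bool using (_≟_)

-- An ordered field (the stdlib has no field / ordered-field bundle).
-- The plane is Carrier × Carrier; the intended model is ℝ.

record OrderedField : Set₁ where
  field
    commutativeRing : CommutativeRing 0ℓ 0ℓ
  open CommutativeRing commutativeRing public
  field
    _≤_          : Rel Carrier 0ℓ
    isTotalOrder : IsTotalOrder _≈_ _≤_
    +-monoˡ-≤    : ∀ {x y} z → x ≤ y → (x + z) ≤ (y + z)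
    *-nonneg     : ∀ {x y} → 0# ≤ x → 0# ≤ y → 0# ≤ (x * y)
    0≉1          : ¬ (0# ≈ 1#)
    inverse      : ∀ x → ¬ (x ≈ 0#) → ∃ λ y → (x * y) ≈ 1#

module _ (F : OrderedField) where
  open OrderedField F

  Point : Set
  Point = Carrier × Carrier

  _≈ₚ_ : Point → Point → Set
  (x₁ , x₂) ≈ₚ (y₁ , y₂) = (x₁ ≈ y₁) × (x₂ ≈ y₂)

  Collinear : Point → Point → Point → Set
  Collinear (a₁ , a₂) (b₁ , b₂) (c₁ , c₂) =
    ((b₁ - a₁) * (c₂ - a₂)) ≈ ((b₂ - a₂) * (c₁ - a₁))

  SegMeet : Point → Point → Point → Point → Set
  SegMeet (x₁ , x₂) (y₁ , y₂) (z₁ , z₂) (w₁ , w₂) =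
    Σ Carrier λ t → Σ Carrier λ u →
      (0# ≤ t) × (t ≤ 1#) × (0# ≤ u) × (u ≤ 1#) ×
      ((((1# - t) * x₁) + (t * y₁)) ≈ (((1# - u) * z₁) + (u * w₁))) ×
      ((((1# - t) * x₂) + (t * y₂)) ≈ (((1# - u) * z₂) + (u * w₂)))

  module _ {n : ℕ} (p : Fin n → Point) where

    Distinct : Set
    Distinct = ∀ i j → ¬ (i ≡ j) → ¬ (p i ≈ₚ p j)

    GeneralPosition : Set
    GeneralPosition = ∀ i j k → ¬ (i ≡ j) → ¬ (j ≡ k) → ¬ (i ≡ k) →
                      ¬ Collinear (p i) (p j) (p k)

-- Segments of n labelled points: unordered pairs {i,j}, stored with i < j.

record Seg (n : ℕ) : Set where
  constructor seg
  field
    fst : Fin n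
    snd : Fin n
    fst<snd : fst Fin.< snd

allSegs : (n : ℕ) → List (Seg n)
allSegs n = concatMap (λ i → concatMap (λ j → pairs i j (i Fin.<? j)) (allFin n)) (allFin n)
  where
  pairs : (i j : Fin n) → Dec (i Fin.< j) → List (Seg n)
  pairs i j (yes i<j) = seg i j i<j ∷ []
  pairs i j (no _)    = []

SegSet : ℕ → Set
SegSet n = Seg n → Bool

_∈ₛ_ : ∀ {n} → Seg n → SegSet n → Set
a ∈ₛ U = U a ≡ true

_∉ₛ_ : ∀ {n} → Seg n → SegSet n → Set
a ∉ₛ U = U a ≡ false

∣_∣ₛ : ∀ {n} → SegSet n → ℕ
∣_∣ₛ {n} U = length (filter (λ a → U a ≟ true) (allSegs n))

module _ {V : Set} (E : V → V → Set) where

  data Walk : V → V → ℕ → Set where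
    here  : ∀ {x} → Walk x x 0
    step  : ∀ {x y z k} → E x y → Walk y z k → Walk x z (ℕ.suc k)

  Dist : V → V → ℕ → Set
  Dist x y k = Walk x y k × (∀ m → m ℕ.< k → ¬ Walk x y m)

  InternalAvoid : (V → Bool) → ∀ {x y k} → Walk x y k → Set
  InternalAvoid U here = ⊤'
    where open import Data.Unit using () renaming (⊤ to ⊤')
  InternalAvoid U (step e here) = ⊤'
    where open import Data.Unit using () renaming (⊤ to ⊤')
  InternalAvoid U (step {y = y} e w@(step _ _)) = (U y ≡ false) × InternalAvoid U w

  MutuallyVisible : (V → Bool) → V → V → Set
  MutuallyVisible U x y =
    Σ ℕ λ k → Dist x y k × Σ (Walk x y k) λ w → InternalAvoid U w

  IsMutualVisibilitySet : (V → Bool) → Set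
  IsMutualVisibilitySet U = ∀ x y → U x ≡ true → U y ≡ true → ¬ (x ≡ y) →
                            MutuallyVisible U x y

module _ (F : OrderedField) {n : ℕ} (p : Fin n → Point F) where

  segMeet : Seg n → Seg n → Set
  segMeet (seg i j _) (seg k l _) = SegMeet F (p i) (p j) (p k) (p l)

  Disjoint : Seg n → Seg n → Set
  Disjoint a b = ¬ segMeet a b

  distD : Seg n → Seg n → ℕ → Set
  distD = Dist Disjoint

  μ≥ : ℕ → Set
  μ≥ m = Σ (SegSet n) λ U → IsMutualVisibilitySet Disjoint U × (m ℕ.≤ ∣ U ∣ₛ)

ExactlyOne4 : Set → Set → Set → Set → Set
ExactlyOne4 A B C D =
  (A ⊎ B ⊎ C ⊎ D) ×
  ¬ (A × B) × ¬ (A × C) × ¬ (A × D) × ¬ (B × C) × ¬ (B × D) × ¬ (C × D)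

{-# OPTIONS --safe #-}
module Submission where

-- The complement U of S is a mutual-visibility set.  Two segments of U are
-- either adjacent, or by hypothesis joined by a shortest path of length 2, 3
-- or 4 whose internal vertices all lie in S, hence outside U; so they are
-- U-mutually visible.  Counting gives |U| = C(n,2) - s.

open import Defs
open import Data.Nat using (ℕ; zero; suc; _+_; _≤_; _∸_)
open import Data.Nat.Combinatorics using (_C_; nC1≡n; nCk+nC[k+1]≡[n+1]C[k+1])
open import Data.Nat.ListAction using (sum)
open import Data.Nat.Properties using (+-suc; m+n∸n≡m; ≤-reflexive)
open import Data.Fin as Fin using (Fin; _<?_)
open import Data.Product using (Σ; _×_; _,_; proj₁)
open import Data.Sum using (inj₁; inj₂)
open import Data.Bool as Bool using (Bool; true; false; not; if_then_else_)
open import Data.Bool.Properties using (not-injective)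
open import Data.List using (List; []; _∷_; length; filter; concatMap; tabulate; allFin)
open import Data.List.Properties using (length-++; tabulate-cong)
open import Data.Unit using (tt)
open import Function using (_∘_)
open import Relation.Nullary using (¬_; yes; no; does)
open import Relation.Nullary.Decidable using (dec-true; dec-false)
open import Relation.Binary.PropositionalEquality
  using (_≡_; refl; sym; trans; cong; cong₂; module ≡-Reasoning)

ltIndicator : ∀ {n} → Fin n → Fin n → ℕ
ltIndicator i j = if does (i <? j) then 1 else 0

countLess : ℕ → ℕ
countLess n = sum (tabulate λ (i : Fin n) → sum (tabulate (ltIndicator i)))

sum-tabulate-1 : ∀ n → sum (tabulate {n = n} λ _ → 1) ≡ n
sum-tabulate-1 zero    = refl
sum-tabulate-1 (suc n) = cong suc (sum-tabulate-1 n)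

-- ltIndicator computes on zero/suc, so row 0 of Fin (suc n) is n ones and the
-- remaining rows are definitionally those of Fin n.
countLess-suc : ∀ n → countLess (suc n) ≡ n + countLess n
countLess-suc n = cong (_+ countLess n) (sum-tabulate-1 n)

countLess≡C2 : ∀ n → countLess n ≡ n C 2
countLess≡C2 zero    = refl
countLess≡C2 (suc n) = begin
  countLess (suc n)   ≡⟨ countLess-suc n ⟩
  n + countLess n     ≡⟨ cong₂ _+_ (sym (nC1≡n n)) (countLess≡C2 n) ⟩
  n C 1 + n C 2       ≡⟨ nCk+nC[k+1]≡[n+1]C[k+1] n 1 ⟩
  suc n C 2           ∎
  where open ≡-Reasoning

length-concatMap-tabulate : ∀ {A B : Set} {n} (f : A → List B) (g : Fin n → A) →
  length (concatMap f (tabulate g)) ≡ sum (tabulate (length ∘ f ∘ g))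
length-concatMap-tabulate {n = zero}  f g = refl
length-concatMap-tabulate {n = suc n} f g =
  trans (length-++ (f (g Fin.zero)))
        (cong (length (f (g Fin.zero)) +_) (length-concatMap-tabulate f (g ∘ Fin.suc)))

-- allSegs is built from a helper local to Defs; segRow n i j, the list
-- contributed to allSegs n by the pair (i, j), is recovered from it by unification.
mutual
  segRow : (n : ℕ) → Fin n → Fin n → List (Seg n)
  segRow n = _

  allSegs≡rows : ∀ n → allSegs n ≡ concatMap (λ i → concatMap (segRow n i) (allFin n)) (allFin n)
  allSegs≡rows n = refl

length-segRow : ∀ n (i j : Fin n) → length (segRow n i j) ≡ ltIndicator i j
length-segRow n i j with i <? j
... | yes i<j = sym (cong (if_then 1 else 0) (dec-true (i <? j) i<j))
... | no i≮j  = sym (cong (if_then 1 else 0) (dec-false (i <? j) i≮j))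

length-allSegs : ∀ n → length (allSegs n) ≡ n C 2
length-allSegs n = begin
  length (allSegs n)
    ≡⟨ cong length (allSegs≡rows n) ⟩
  length (concatMap (λ i → concatMap (segRow n i) (allFin n)) (allFin n))
    ≡⟨ length-concatMap-tabulate (λ i → concatMap (segRow n i) (allFin n)) (λ i → i) ⟩
  sum (tabulate λ i → length (concatMap (segRow n i) (allFin n)))
    ≡⟨ cong sum (tabulate-cong λ i → trans (length-concatMap-tabulate (segRow n i) (λ j → j))
                                           (cong sum (tabulate-cong (length-segRow n i)))) ⟩
  countLess n
    ≡⟨ countLess≡C2 n ⟩
  n C 2 ∎
  where open ≡-Reasoning

length-filter-not+length-filter : ∀ {A : Set} (f : A → Bool) (xs : List A) →
  length (filter (λ a → not (f a) Bool.≟ true) xs) + length (filter (λ a → f a Bool.≟ true) xs)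
    ≡ length xs
length-filter-not+length-filter f []       = refl
length-filter-not+length-filter f (x ∷ xs) with f x
... | true  = trans (+-suc _ _) (cong suc (length-filter-not+length-filter f xs))
... | false = cong suc (length-filter-not+length-filter f xs)

∁ₛ : ∀ {n} → SegSet n → SegSet n
∁ₛ S a = not (S a)

∣∁ₛ∣ : ∀ {n} (S : SegSet n) → n C 2 ∸ ∣ S ∣ₛ ≡ ∣ ∁ₛ S ∣ₛ
∣∁ₛ∣ {n} S = begin
  n C 2 ∸ ∣ S ∣ₛ
    ≡⟨ cong (_∸ ∣ S ∣ₛ) (sym (length-allSegs n)) ⟩
  length (allSegs n) ∸ ∣ S ∣ₛ
    ≡⟨ cong (_∸ ∣ S ∣ₛ) (sym (length-filter-not+length-filter S (allSegs n))) ⟩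
  ∣ ∁ₛ S ∣ₛ + ∣ S ∣ₛ ∸ ∣ S ∣ₛ
    ≡⟨ m+n∸n≡m ∣ ∁ₛ S ∣ₛ ∣ S ∣ₛ ⟩
  ∣ ∁ₛ S ∣ₛ ∎
  where open ≡-Reasoning

∈ₛ⇒∉ₛ∁ₛ : ∀ {n} (S : SegSet n) {a} → a ∈ₛ S → a ∉ₛ ∁ₛ S
∈ₛ⇒∉ₛ∁ₛ S = cong not

∈ₛ∁ₛ⇒∉ₛ : ∀ {n} (S : SegSet n) {a} → a ∈ₛ ∁ₛ S → a ∉ₛ S
∈ₛ∁ₛ⇒∉ₛ S = not-injective

module _ (F : OrderedField) where
  open OrderedField F using () renaming (sym to ≈-sym)

  SegMeet-sym : ∀ {x y z w} → SegMeet F x y z w → SegMeet F z w x y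
  SegMeet-sym (t , u , 0≤t , t≤1 , 0≤u , u≤1 , e₁ , e₂) =
    u , t , 0≤u , u≤1 , 0≤t , t≤1 , ≈-sym e₁ , ≈-sym e₂

  Disjoint-sym : ∀ {n} (p : Fin n → Point F) {a b} → Disjoint F p a b → Disjoint F p b a
  Disjoint-sym p {seg _ _ _} {seg _ _ _} a∩b=∅ b∩a≠∅ = a∩b=∅ (SegMeet-sym b∩a≠∅)

lemma1 : (F : OrderedField) (n : ℕ) (p : Fin n → Point F) →
         5 ≤ n → Distinct F p → GeneralPosition F p →
         (S : SegSet n) →
         (∀ (a b : Seg n) → a ∉ₛ S → b ∉ₛ S → ¬ (a ≡ b) →
           ExactlyOne4
             (distD F p a b 1)
             (distD F p a b 2 ×
               Σ (Seg n) λ f₁ → f₁ ∈ₛ S × Disjoint F p a f₁ × Disjoint F p b f₁)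
             (distD F p a b 3 ×
               Σ (Seg n) λ f₁ → Σ (Seg n) λ f₂ → f₁ ∈ₛ S × f₂ ∈ₛ S ×
                 Disjoint F p a f₁ × Disjoint F p f₁ f₂ × Disjoint F p f₂ b)
             (distD F p a b 4 × n ≡ 5 ×
               Σ (Seg n) λ f₁ → Σ (Seg n) λ f₂ → Σ (Seg n) λ f₃ →
                 f₁ ∈ₛ S × f₂ ∈ₛ S × f₃ ∈ₛ S ×
                 Disjoint F p a f₁ × Disjoint F p f₃ b ×
                 segMeet F p a f₂ × segMeet F p a f₃ ×
                 segMeet F p b f₁ × segMeet F p b f₂ ×
                 Disjoint F p f₁ f₂ × Disjoint F p f₂ f₃ ×
                 segMeet F p f₁ f₃)) →
         μ≥ F p ((n C 2) ∸ ∣ S ∣ₛ)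
lemma1 F n p _ _ _ S conditions = ∁ₛ S , visible , ≤-reflexive (∣∁ₛ∣ S)
  where
  avoids : ∀ {f} → f ∈ₛ S → f ∉ₛ ∁ₛ S
  avoids = ∈ₛ⇒∉ₛ∁ₛ S

  visible : IsMutualVisibilitySet (Disjoint F p) (∁ₛ S)
  visible a b a∈U b∈U a≢b
    with proj₁ (conditions a b (∈ₛ∁ₛ⇒∉ₛ S a∈U) (∈ₛ∁ₛ⇒∉ₛ S b∈U) a≢b)
  ... | inj₁ d@(step a∩b=∅ here , _) = 1 , d , step a∩b=∅ here , tt
  ... | inj₂ (inj₁ (d , f₁ , f₁∈S , a∩f₁=∅ , b∩f₁=∅)) =
    2 , d , step a∩f₁=∅ (step (Disjoint-sym F p {b} {f₁} b∩f₁=∅) here) , avoids f₁∈S , tt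
  ... | inj₂ (inj₂ (inj₁ (d , f₁ , f₂ , f₁∈S , f₂∈S , a∩f₁=∅ , f₁∩f₂=∅ , f₂∩b=∅))) =
    3 , d , step a∩f₁=∅ (step f₁∩f₂=∅ (step f₂∩b=∅ here)) , avoids f₁∈S , avoids f₂∈S , tt
  ... | inj₂ (inj₂ (inj₂ (d , _ , f₁ , f₂ , f₃ , f₁∈S , f₂∈S , f₃∈S , a∩f₁=∅ , f₃∩b=∅ ,
                          _ , _ , _ , _ , f₁∩f₂=∅ , f₂∩f₃=∅ , _))) =
    4 , d , step a∩f₁=∅ (step f₁∩f₂=∅ (step f₂∩f₃=∅ (step f₃∩b=∅ here))) ,
    avoids f₁∈S , avoids f₂∈S , avoids f₃∈S , tt
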